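{- With the notation of the context (Algorithm 1 applied to $s=s_m\dots s_1$), for every $k$ with $2\le k\le m$ we have $z_{3,k}\le a_k$, and $z_{3,1}\le a_1-1$.
   Context: Let $a$ be a real number with infinite continued fraction expansion $[a_0;a_1,a_2,\dots]$ ($a_0\in\mathbb{Z}$, $a_i$ positive integers for $i\ge1$). Set $q_{ -1}=0$, $q_0=1$, $q_{k+1}=a_{k+1}q_k+q_{k-1}$. The Ostrowski representation of $N\in\mathbb{N}$ is the unique word $b_n\dots b_1$ with $N=\sum_{k=0}^{n}b_{k+1}q_k$, $b_k\in\mathbb{N}$, $b_1<a_1$, $b_k\le a_k$, and $b_{k-1}=0$ whenever $b_k=a_k$. A word is written $u_r\dots u_1$; $u_i$ is the entry at position $i$. Let $M,N\in\mathbb{N}$ have Ostrowski representations $x_n\dots x_1$ and $y_n\dots y_1$ (padded with leading zeros to a common length $n$). Let $m=n+1$, $s_i=x_i+y_i$ for $1\le i\le n$, $s_m=0$, and $s=s_m\dots s_1$. Algorithm 1 defines words $z_k=z_{k,m}\dots z_{k,1}$ for $k=m+1,m,\dots,3$ recursively (in decreasing $k$). Put $z_{m+1}=s$. For $4\le k\le m$: $z_{k,i}=z_{k+1,i}$ for $i\notin\{k,k-1,k-2,k-3\}$, and (A1) if $z_{k+1,k}<a_k$, $z_{k+1,k-1}>a_{k-1}$ and $z_{k+1,k-2}=0$, then $(z_{k,k},z_{k,k-1},z_{k,k-2},z_{k,k-3})=(z_{k+1,k}+1,\ z_{k+1,k-1}-(a_{k-1}+1),\ a_{k-2}-1,\ z_{k+1,k-3}+1)$;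 (A2) if $z_{k+1,k}<a_k$, $a_{k-1}\le z_{k+1,k-1}\le 2a_{k-1}$ and $z_{k+1,k-2}>0$, then $(z_{k,k},z_{k,k-1},z_{k,k-2},z_{k,k-3})=(z_{k+1,k}+1,\ z_{k+1,k-1}-a_{k-1},\ z_{k+1,k-2}-1,\ z_{k+1,k-3})$; (A3) otherwise these four entries are unchanged from $z_{k+1}$. For $k=3$: $z_{3,i}=z_{4,i}$ for $i\notin\{1,2,3\}$, and (B1) if $z_{4,3}<a_3$, $z_{4,2}>a_2$, $z_{4,1}=0$: $(z_{3,3},z_{3,2},z_{3,1})=(z_{4,3}+1,\ z_{4,2}-(a_2+1),\ a_1-1)$; (B2) if $z_{4,3}<a_3$, $z_{4,2}\ge a_2$, $a_1\ge z_{4,1}>0$: $(z_{4,3}+1,\ z_{4,2}-a_2,\ z_{4,1}-1)$; (B3) if $z_{4,3}<a_3$, $z_{4,2}\ge a_2$, $z_{4,1}>a_1$: $(z_{4,3}+1,\ z_{4,2}-a_2+1,\ z_{4,1}-a_1-1)$; (B4) if $z_{4,2}<a_2$, $z_{4,1}\ge a_1$: $(z_{4,3},\ z_{4,2}+1,\ z_{4,1}-a_1)$; (B5) otherwise unchanged. -}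

module Defs where

open import Data.Nat using (ℕ; zero; suc; _+_; _*_; _∸_; _≤_; _<_; _<ᵇ_; _≤ᵇ_; _≡ᵇ_)
open import Data.Bool using (Bool; true; false; if_then_else_; _∧_)
open import Relation.Binary.PropositionalEquality using (_≡_)

-- Partial quotients: a i = a_i for i ≥ 1 (a 0 plays no role in the statement).
-- A word u_r … u_1 is represented as a function from positions to digits:
-- position i ↦ u_i (positions are 1-based; values outside the range are ignored).
Word : Set
Word = ℕ → ℕ

-- q_{-1} = 0, q_0 = 1, q_{k+1} = a_{k+1} q_k + q_{k-1}
q : (ℕ → ℕ) → ℕ → ℕ
q a zero = 1
q a (suc zero) = a 1 * 1 + 0
q a (suc (suc k)) = a (suc (suc k)) * q a (suc k) + q a k

ostValue : (ℕ → ℕ) → ℕ → Word → ℕ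
ostValue a zero x = 0
ostValue a (suc n) x = ostValue a n x + x (suc n) * q a n

-- x_n … x_1 is the Ostrowski representation of N (of length n, leading zeros allowed)
record IsOstrowskiRep (a : ℕ → ℕ) (n : ℕ) (x : Word) (N : ℕ) : Set where
  field
    value    : ostValue a n x ≡ N
    first<   : 1 ≤ n → x 1 < a 1
    bounded  : ∀ k → 1 ≤ k → k ≤ n → x k ≤ a k
    zeroBelow : ∀ k → 2 ≤ k → k ≤ n → x k ≡ a k → x (k ∸ 1) ≡ 0

sumWord : ℕ → Word → Word → Word
sumWord n x y i = if (1 ≤ᵇ i) ∧ (i ≤ᵇ n) then x i + y i else 0

set4 : ℕ → Word → ℕ → ℕ → ℕ → ℕ → Word
set4 k w c0 c1 c2 c3 i =
  if i ≡ᵇ k then c0 else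
  if i ≡ᵇ (k ∸ 1) then c1 else
  if i ≡ᵇ (k ∸ 2) then c2 else
  if i ≡ᵇ (k ∸ 3) then c3 else w i

set3 : Word → ℕ → ℕ → ℕ → Word
set3 w c3 c2 c1 i =
  if i ≡ᵇ 3 then c3 else
  if i ≡ᵇ 2 then c2 else
  if i ≡ᵇ 1 then c1 else w i

-- step k (4 ≤ k ≤ m): z_k from z_{k+1} = w   (cases A1, A2, A3)
stepA : (ℕ → ℕ) → ℕ → Word → Word
stepA a k w =
  if (w k <ᵇ a k) ∧ (a (k ∸ 1) <ᵇ w (k ∸ 1)) ∧ (w (k ∸ 2) ≡ᵇ 0)
  then set4 k w (w k + 1) (w (k ∸ 1) ∸ (a (k ∸ 1) + 1)) (a (k ∸ 2) ∸ 1) (w (k ∸ 3) + 1)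
  else if (w k <ᵇ a k) ∧ (a (k ∸ 1) ≤ᵇ w (k ∸ 1)) ∧ (w (k ∸ 1) ≤ᵇ 2 * a (k ∸ 1)) ∧ (0 <ᵇ w (k ∸ 2))
  then set4 k w (w k + 1) (w (k ∸ 1) ∸ a (k ∸ 1)) (w (k ∸ 2) ∸ 1) (w (k ∸ 3))
  else w

-- step k = 3: z_3 from z_4 = w   (cases B1–B5)
stepB : (ℕ → ℕ) → Word → Word
stepB a w =
  if (w 3 <ᵇ a 3) ∧ (a 2 <ᵇ w 2) ∧ (w 1 ≡ᵇ 0)
  then set3 w (w 3 + 1) (w 2 ∸ (a 2 + 1)) (a 1 ∸ 1)
  else if (w 3 <ᵇ a 3) ∧ (a 2 ≤ᵇ w 2) ∧ (w 1 ≤ᵇ a 1) ∧ (0 <ᵇ w 1)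
  then set3 w (w 3 + 1) (w 2 ∸ a 2) (w 1 ∸ 1)
  else if (w 3 <ᵇ a 3) ∧ (a 2 ≤ᵇ w 2) ∧ (a 1 <ᵇ w 1)
  then set3 w (w 3 + 1) ((w 2 ∸ a 2) + 1) (w 1 ∸ a 1 ∸ 1)
  else if (w 2 <ᵇ a 2) ∧ (a 1 ≤ᵇ w 1)
  then set3 w (w 3) (w 2 + 1) (w 1 ∸ a 1)
  else w

-- stepsDown a k w applies stepA for k, k-1, …, 4 (in this order) to w;
-- so stepsDown a m z_{m+1} = z_4.
stepsDown : (ℕ → ℕ) → ℕ → Word → Word
stepsDown a (suc (suc (suc (suc j)))) w = stepsDown a (suc (suc (suc j))) (stepA a (suc (suc (suc (suc j)))) w)
stepsDown a _ w = w

-- z_3 produced by Algorithm 1 from s with m = length of s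
algorithm1 : (ℕ → ℕ) → ℕ → Word → Word
algorithm1 a m s = stepB a (stepsDown a m s)

module Submission where

-- Let s be the digitwise sum of two Ostrowski representations.  The step at
-- position k only touches positions k, k-1, k-2, k-3, so we follow this
-- window down the word with an invariant `Inv j w` for the word w before the
-- step at 3 + j:
--   * digits below position 1+j are still those of s,
--   * digits from position 3+j upwards are at most a_i, and a full digit
--     a_{3+j} forces the digit below it under a_{2+j},
--   * the digit at 2+j "fits" over the one at 1+j (record `Fits`: at most
--     2a+1, and the two largest values constrain the lower digit), and the
--     digit at 1+j fits over the digit of s at position j (`Room`).

open import Defs
open import Data.Nat using (ℕ; zero; suc; _+_; _*_; _∸_; _≤_; _<_; _≡ᵇ_; z≤n; s≤s; s≤s⁻¹; z<s; s<s; _≤?_; _<?_; _≟_)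
open import Data.Nat.Properties
open import Data.Bool using (if_then_else_)
open import Data.Empty using (⊥-elim)
open import Data.Sum using (_⊎_; inj₁; inj₂)
open import Data.Product using (_×_; _,_; proj₁; proj₂)
open import Relation.Nullary using (¬_; Dec; yes; no; does)
open import Relation.Nullary.Decidable using (_×-dec_)
open import Relation.Binary.PropositionalEquality

-- Every Boolean test in Defs is definitionally `does d` for a decision d
-- built from _<?_, _≤?_, _≟_ and _×-dec_; so a branch of the algorithm is
-- analysed by case analysis on d.
if-dec : ∀ {P B : Set} (Q : B → Set) {x y : B} (d : Dec P) →
         (P → Q x) → (¬ P → Q y) → Q (if does d then x else y)
if-dec Q (yes p) onYes onNo = onYes p
if-dec Q (no ¬p) onYes onNo = onNo ¬p

if-yes : ∀ {P B : Set} {x y : B} (d : Dec P) → P → (if does d then x else y) ≡ x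
if-yes d p = if-dec (λ v → v ≡ _) d (λ _ → refl) (λ ¬p → ⊥-elim (¬p p))

if-no : ∀ {P B : Set} {x y : B} (d : Dec P) → ¬ P → (if does d then x else y) ≡ y
if-no d ¬p = if-dec (λ v → v ≡ _) d (λ p → ⊥-elim (¬p p)) (λ _ → refl)

module Window (j : ℕ) (w : Word) (c0 c1 c2 c3 : ℕ) where

  private
    W : Word
    W = set4 (4 + j) w c0 c1 c2 c3

    skip : ∀ {B : Set} {x y : B} {i k} → i ≢ k → (if i ≡ᵇ k then x else y) ≡ y
    skip {i = i} {k} = if-no (i ≟ k)

    hit : ∀ {B : Set} {x y : B} i → (if i ≡ᵇ i then x else y) ≡ x
    hit i = if-yes (i ≟ i) refl

    apart : ∀ {c d} → c < d → c + j ≢ d + j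
    apart c<d = <⇒≢ (+-monoˡ-< j c<d)

  at4 : W (4 + j) ≡ c0
  at4 = hit (4 + j)

  at3 : W (3 + j) ≡ c1
  at3 = trans (skip (apart (s<s (s<s (s<s z<s))))) (hit (3 + j))

  at2 : W (2 + j) ≡ c2
  at2 = trans (skip (apart (s<s (s<s z<s)))) (trans (skip (apart (s<s z<s))) (hit (2 + j)))

  at1 : W (1 + j) ≡ c3
  at1 = trans (skip (apart (s<s z<s))) (trans (skip (apart (s<s z<s)))
          (trans (skip (apart z<s)) (hit (1 + j))))

  below : ∀ i → i ≤ j → W i ≡ w i
  below i i≤j = trans (skip (lower 3)) (trans (skip (lower 2)) (trans (skip (lower 1)) (skip (lower 0))))
    where
    lower : ∀ d → i ≢ suc d + j
    lower d = <⇒≢ (s≤s (≤-trans i≤j (m≤n+m j d)))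

  above : ∀ i → 4 + j < i → W i ≡ w i
  above i h = trans (skip (higher 0)) (trans (skip (higher 1)) (trans (skip (higher 2)) (skip (higher 3))))
    where
    higher : ∀ d → i ≢ (4 + j) ∸ d
    higher d = >⇒≢ (≤-<-trans (m∸n≤m (4 + j) d) h)

set3-above : ∀ w c3 c2 c1 i → 3 < i → set3 w c3 c2 c1 i ≡ w i
set3-above w c3 c2 c1 i h =
  trans (if-no (i ≟ 3) (>⇒≢ h))
  (trans (if-no (i ≟ 2) (>⇒≢ (<-trans (n<1+n 2) h)))
  (if-no (i ≟ 1) (>⇒≢ (<-trans (n<1+n 1) (<-trans (n<1+n 2) h)))))

twice : ∀ A → 2 * A ≡ A + A
twice A = cong (A +_) (+-identityʳ A)

≤-double : ∀ A → A ≤ 2 * A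
≤-double A = m≤m+n A (A + 0)

<⇒+1≤ : ∀ {u A} → u < A → u + 1 ≤ A
<⇒+1≤ {u} {A} = subst (_≤ A) (+-comm 1 u)

<⇒≤∸1 : ∀ {u A} → u < A → u ≤ A ∸ 1
<⇒≤∸1 {A = suc A} (s≤s u≤A) = u≤A

∸1< : ∀ {u A} → 0 < u → u ≤ A → u ∸ 1 < A
∸1< {suc u} _ u<A = u<A

below-full : ∀ {u N} → u ≤ suc N → u ≢ suc N → u ≤ N
below-full h ne = s≤s⁻¹ (≤∧≢⇒< h ne)

half-∸ : ∀ {u A} → u ≤ 2 * A → u ∸ A ≤ A
half-∸ {u} {A} h = m≤n+o⇒m∸n≤o u A (subst (u ≤_) (twice A) h)

half-∸suc : ∀ {u A} → u ≤ suc (2 * A) → u ∸ (A + 1) ≤ A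
half-∸suc {u} {A} h = m≤n+o⇒m∸n≤o u (A + 1) (subst (u ≤_) split h)
  where
  split : suc (2 * A) ≡ A + 1 + A
  split = trans (cong suc (twice A)) (sym (trans (+-assoc A 1 A) (+-suc A A)))

half-∸-strict : ∀ {u A} → A ≤ u → u < 2 * A → u ∸ A < A
half-∸-strict {u} {A} A≤u u<2A = subst (_≤ A) (+-∸-assoc 1 A≤u) (half-∸ u<2A)

half-∸-eq : ∀ {u A} → A ≤ u → u ∸ A ≡ A → u ≡ 2 * A
half-∸-eq {u} {A} A≤u e = trans (sym (m∸n+n≡m A≤u)) (trans (cong (_+ A) e) (sym (twice A)))

sum-max : ∀ {X Y A} → X ≤ A → Y ≤ A → X + Y ≡ A + A → X ≡ A
sum-max hX hY e = ≤-antisym hX (≮⇒≥ λ lt → <-irrefl e (+-mono-<-≤ lt hY))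

sum-near-max : ∀ {X Y A} → X ≤ A → Y ≤ A → suc (X + Y) ≡ A + A → X ≡ A ⊎ Y ≡ A
sum-near-max {X} {Y} {A} hX hY e with X ≟ A | Y ≟ A
... | yes X≡A | _       = inj₁ X≡A
... | no _    | yes Y≡A = inj₂ Y≡A
... | no X≢A  | no Y≢A  = ⊥-elim (<-irrefl e (subst (_≤ A + A) (+-suc (suc X) Y)
                            (+-mono-≤ (≤∧≢⇒< hX X≢A) (≤∧≢⇒< hY Y≢A))))

sumWord-inside : ∀ {n} x y {i} → 1 ≤ i → i ≤ n → sumWord n x y i ≡ x i + y i
sumWord-inside {n} x y {i} h1 h2 = if-yes (1 ≤? i ×-dec i ≤? n) (h1 , h2)

sumWord-outside : ∀ {n} x y {i} → n < i → sumWord n x y i ≡ 0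
sumWord-outside {n} x y {i} h = if-no (1 ≤? i ×-dec i ≤? n) (λ (_ , i≤n) → <⇒≱ h i≤n)

module Digits (a : ℕ → ℕ) (a-pos : ∀ p → 1 ≤ a (suc p)) where

  record Fits (p u v : ℕ) : Set where
    field
      bound : u ≤ suc (2 * a (suc p))
      full  : u ≡ suc (2 * a (suc p)) → v ≡ 0
      even  : u ≡ 2 * a (suc p) → v ≤ a p
  open Fits public

  fits-pred : ∀ {p u v} → Fits p (suc u) v → Fits p u v
  fits-pred {p} {u} {v} F = record
    { bound = ≤-trans (n≤1+n u) (bound F)
    ; full  = λ e → ⊥-elim (1+n≰n (subst (λ z → suc z ≤ suc (2 * a (suc p))) e (bound F)))
    ; even  = λ e → subst (_≤ a p) (sym (full F (cong suc e))) z≤n }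

  fits-∸1 : ∀ {p u v} → 0 < u → Fits p u v → Fits p (u ∸ 1) v
  fits-∸1 {u = suc u} _ = fits-pred

  fits-< : ∀ {p u v} → u < a (suc p) → Fits p u v
  fits-< {p} {u} u<A = record
    { bound = ≤-trans (<⇒≤ u<A) (≤-trans (≤-double A) (n≤1+n _))
    ; full  = λ e → ⊥-elim (<⇒≱ u<A (subst (A ≤_) (sym e) (≤-trans (≤-double A) (n≤1+n _))))
    ; even  = λ e → ⊥-elim (<⇒≱ u<A (subst (A ≤_) (sym e) (≤-double A))) }
    where A = a (suc p)

  fits-one : ∀ {p v} → Fits p 1 v
  fits-one {p} = record
    { bound = s≤s z≤n
    ; full  = λ e → ⊥-elim (≤⇒≯ (subst (2 ≤_) (sym (suc-injective e)) two≤) z<s)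
    ; even  = λ e → ⊥-elim (≤⇒≯ (subst (2 ≤_) (sym e) two≤) ≤-refl) }
    where
    two≤ : 2 ≤ 2 * a (suc p)
    two≤ = *-monoʳ-≤ 2 (a-pos p)

  digit-pair-sum : ∀ {p X Y X′ Y′} → X ≤ a (suc p) → Y ≤ a (suc p) →
    (X ≡ a (suc p) → X′ ≡ 0) → (Y ≡ a (suc p) → Y′ ≡ 0) → X′ ≤ a p → Y′ ≤ a p →
    Fits p (suc (X + Y)) (X′ + Y′)
  digit-pair-sum {p} {X} {Y} {X′} {Y′} hX hY zX zY hX′ hY′ = record
    { bound = s≤s (subst (X + Y ≤_) (sym (twice A)) (+-mono-≤ hX hY))
    ; full  = λ e → full-sum (trans (suc-injective e) (twice A))
    ; even  = λ e → even-sum (sum-near-max hX hY (trans e (twice A))) }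
    where
    A = a (suc p)
    full-sum : X + Y ≡ A + A → X′ + Y′ ≡ 0
    full-sum e = cong₂ _+_ (zX (sum-max hX hY e)) (zY (sum-max hY hX (trans (+-comm Y X) e)))
    even-sum : X ≡ A ⊎ Y ≡ A → X′ + Y′ ≤ a p
    even-sum (inj₁ X≡A) = subst (λ v → v + Y′ ≤ a p) (sym (zX X≡A)) hY′
    even-sum (inj₂ Y≡A) = subst (λ v → X′ + v ≤ a p) (sym (zY Y≡A))
                            (subst (_≤ a p) (sym (+-identityʳ X′)) hX′)

  Room : Word → ℕ → ℕ → Set
  Room s zero    r = suc r ≤ 2 * a 1
  Room s (suc p) r = Fits (suc p) r (s (suc p))

  room-pred : ∀ s p {r} → Room s p (suc r) → Room s p r
  room-pred s zero    h = <⇒≤ h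
  room-pred s (suc p) h = fits-pred h

  -- Key property of the digitwise sum of two Ostrowski representations:
  -- every digit still has room for an additional carry.
  sumWord-carry : ∀ {n x y M N} → IsOstrowskiRep a n x M → IsOstrowskiRep a n y N →
    ∀ p → Room (sumWord n x y) p (suc (sumWord n x y (suc p)))
  sumWord-carry {n} {x} {y} ox oy p with suc p ≤? n
  ... | no out = subst (λ v → Room s p (suc v)) (sym (sumWord-outside x y (≰⇒> out))) (room-one p)
    where
    s = sumWord n x y
    room-one : ∀ p → Room s p 1
    room-one zero    = *-monoʳ-≤ 2 (a-pos 0)
    room-one (suc p) = fits-one
  ... | yes p<n = subst (λ v → Room s p (suc v)) (sym (sumWord-inside x y (s≤s z≤n) p<n)) (inside p p<n)
    where
    open IsOstrowskiRep
    s = sumWord n x y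
    inside : ∀ p → suc p ≤ n → Room s p (suc (x (suc p) + y (suc p)))
    inside zero h = subst₂ _≤_ (cong suc (+-suc (x 1) (y 1))) (sym (twice (a 1)))
                      (+-mono-≤ (first< ox h) (first< oy h))
    inside (suc q) h = subst (Fits (suc q) _) (sym (sumWord-inside x y (s≤s z≤n) h′))
      (digit-pair-sum (bounded ox _ (s≤s z≤n) h) (bounded oy _ (s≤s z≤n) h)
        (zeroBelow ox _ (s≤s (s≤s z≤n)) h) (zeroBelow oy _ (s≤s (s≤s z≤n)) h)
        (bounded ox _ (s≤s z≤n) h′) (bounded oy _ (s≤s z≤n) h′))
      where
      h′ : suc q ≤ n
      h′ = ≤-trans (n≤1+n _) h

  extend-above : ∀ {W : Word} k → W (suc k) ≤ a (suc k) →
    (∀ i → suc k < i → W i ≤ a i) → ∀ i → k < i → W i ≤ a i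
  extend-above k top rest i k<i with m≤n⇒m<n∨m≡n k<i
  ... | inj₁ lt   = rest i lt
  ... | inj₂ refl = top

  module Run (s : Word) (carry : ∀ p → Room s p (suc (s (suc p)))) where

    -- Invariant before the step at position 3 + j.
    record Inv (j : ℕ) (w : Word) : Set where
      field
        below   : ∀ i → i ≤ j → w i ≡ s i
        above   : ∀ i → 3 + j < i → w i ≤ a i
        top     : w (3 + j) ≤ a (3 + j)
        topFull : w (3 + j) ≡ a (3 + j) → w (2 + j) < a (2 + j)
        mid     : Fits (1 + j) (w (2 + j)) (w (1 + j))
        low     : Room s j (w (1 + j))
    open Inv

    -- The digits s(1+j) and s(2+j) survive until the step at 4 + j.
    low-next : ∀ {j w} → Inv (suc j) w → Room s j (w (1 + j))
    low-next {j} I = subst (Room s j) (sym (below I (1 + j) ≤-refl)) (room-pred s j (carry j))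

    mid-next : ∀ {j w} → Inv (suc j) w → Fits (1 + j) (w (2 + j)) (w (1 + j))
    mid-next {j} {w} I = subst (Fits (1 + j) (w (2 + j))) (sym (below I (1 + j) ≤-refl)) (low I)

    assemble : ∀ {j w c0 c1 c2 c3} → Inv (suc j) w →
      c0 ≤ a (4 + j) → c1 ≤ a (3 + j) → (c1 ≡ a (3 + j) → c2 < a (2 + j)) →
      Fits (1 + j) c2 c3 → Room s j c3 → Inv j (set4 (4 + j) w c0 c1 c2 c3)
    assemble {j} {w} {c0} {c1} {c2} {c3} I new top′ topFull′ mid′ low′ = record
      { below   = λ i i≤j → trans (below′ i i≤j) (below I i (m≤n⇒m≤1+n i≤j))
      ; above   = extend-above (3 + j) (subst (_≤ a (4 + j)) (sym at4) new)
                    λ i h → subst (_≤ a i) (sym (above′ i h)) (above I i h)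
      ; top     = subst (_≤ a (3 + j)) (sym at3) top′
      ; topFull = λ e → subst (_< a (2 + j)) (sym at2) (topFull′ (trans (sym at3) e))
      ; mid     = subst₂ (Fits (1 + j)) (sym at2) (sym at1) mid′
      ; low     = subst (Room s j) (sym at1) low′ }
      where open Window j w c0 c1 c2 c3 renaming (below to below′; above to above′)

    keep : ∀ {j w} → Inv (suc j) w → w (3 + j) ≤ a (3 + j) →
      (w (3 + j) ≡ a (3 + j) → w (2 + j) < a (2 + j)) → Inv j w
    keep {j} I top′ topFull′ = record
      { below   = λ i i≤j → below I i (m≤n⇒m≤1+n i≤j)
      ; above   = extend-above (3 + j) (top I) (above I)
      ; top     = top′
      ; topFull = topFull′
      ; mid     = mid-next I
      ; low     = low-next I }

    A1 A2 : ℕ → Word → Set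
    A1 j w = w (4 + j) < a (4 + j) × a (3 + j) < w (3 + j) × w (2 + j) ≡ 0
    A2 j w = w (4 + j) < a (4 + j) × a (3 + j) ≤ w (3 + j) × w (3 + j) ≤ 2 * a (3 + j) × 0 < w (2 + j)

    -- Case A1: a carry moves up from position 3+j, borrowing through 2+j.
    caseA1 : ∀ j w → Inv (suc j) w → A1 j w →
      Inv j (set4 (4 + j) w (w (4 + j) + 1) (w (3 + j) ∸ (a (3 + j) + 1)) (a (2 + j) ∸ 1) (w (1 + j) + 1))
    caseA1 j w I (lt4 , _ , _) =
      assemble I (<⇒+1≤ lt4) (half-∸suc (bound (mid I))) (λ _ → a∸1<a) (fits-< a∸1<a)
        (subst (Room s j) carried (carry j))
      where
      a∸1<a : a (2 + j) ∸ 1 < a (2 + j)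
      a∸1<a = ∸1< (a-pos (1 + j)) ≤-refl
      carried : suc (s (1 + j)) ≡ w (1 + j) + 1
      carried = trans (+-comm 1 _) (cong (_+ 1) (sym (below I (1 + j) ≤-refl)))

    -- Case A2: a carry moves up from position 3+j, paid for by one unit at 2+j.
    caseA2 : ∀ j w → Inv (suc j) w → A2 j w →
      Inv j (set4 (4 + j) w (w (4 + j) + 1) (w (3 + j) ∸ a (3 + j)) (w (2 + j) ∸ 1) (w (1 + j)))
    caseA2 j w I (lt4 , ge3 , le3 , pos2) =
      assemble I (<⇒+1≤ lt4) (half-∸ le3)
        (λ e → ∸1< pos2 (even (mid I) (half-∸-eq ge3 e)))
        (fits-∸1 pos2 (mid-next I)) (low-next I)

    caseA3 : ∀ j w → Inv (suc j) w → ¬ A1 j w → ¬ A2 j w → Inv j w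
    caseA3 j w I ¬a1 ¬a2 with w (4 + j) <? a (4 + j)
    ... | no ¬lt4 = keep I (<⇒≤ lt3) (λ e → ⊥-elim (<-irrefl e lt3))
      where
      lt3 : w (3 + j) < a (3 + j)
      lt3 = topFull I (≤-antisym (top I) (≮⇒≥ ¬lt4))
    ... | yes lt4 = keep I top3 topFull3
      where
      top3 : w (3 + j) ≤ a (3 + j)
      top3 with w (3 + j) ≤? a (3 + j)
      ... | yes le3 = le3
      ... | no ¬le3 = ⊥-elim (¬a2 (lt4 , <⇒≤ gt3 ,
                        below-full (bound (mid I)) (λ e → nz (full (mid I) e)) , n≢0⇒n>0 nz))
        where
        gt3 : a (3 + j) < w (3 + j)
        gt3 = ≰⇒> ¬le3
        nz : w (2 + j) ≢ 0
        nz z = ¬a1 (lt4 , gt3 , z)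
      topFull3 : w (3 + j) ≡ a (3 + j) → w (2 + j) < a (2 + j)
      topFull3 e with w (2 + j) ≟ 0
      ... | yes z  = subst (_< a (2 + j)) (sym z) (a-pos (1 + j))
      ... | no nz = ⊥-elim (¬a2 (lt4 , ≤-reflexive (sym e) ,
                      subst (_≤ 2 * a (3 + j)) (sym e) (≤-double _) , n≢0⇒n>0 nz))

    step : ∀ j w → Inv (suc j) w → Inv j (stepA a (4 + j) w)
    step j w I =
      if-dec (Inv j) (w (4 + j) <? a (4 + j) ×-dec a (3 + j) <? w (3 + j) ×-dec w (2 + j) ≟ 0)
        (caseA1 j w I) λ ¬a1 →
      if-dec (Inv j) (w (4 + j) <? a (4 + j) ×-dec a (3 + j) ≤? w (3 + j) ×-dec
                      w (3 + j) ≤? 2 * a (3 + j) ×-dec 0 <? w (2 + j))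
        (caseA2 j w I) (caseA3 j w I ¬a1)

    down : ∀ j w → Inv j w → Inv 0 (stepsDown a (3 + j) w)
    down zero    w I = I
    down (suc j) w I = down j (stepA a (4 + j) w) (step j w I)

    -- Initially the window sits at the top, where s vanishes.
    start : ∀ j → (∀ i → 2 + j < i → s i ≡ 0) → Inv j s
    start j vanish = record
      { below   = λ _ _ → refl
      ; above   = λ i h → subst (_≤ a i) (sym (vanish i (<-trans (n<1+n _) h))) z≤n
      ; top     = subst (_≤ a (3 + j)) (sym zero3) z≤n
      ; topFull = λ e → ⊥-elim (>⇒≢ (a-pos (2 + j)) (trans (sym e) zero3))
      ; mid     = fits-pred (carry (suc j))
      ; low     = room-pred s j (carry j) }
      where
      zero3 : s (3 + j) ≡ 0
      zero3 = vanish (3 + j) ≤-refl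

    Conclusion : Word → Set
    Conclusion W = (∀ k → 2 ≤ k → W k ≤ a k) × (W 1 ≤ a 1 ∸ 1)

    conclude : ∀ {W : Word} → W 3 ≤ a 3 → W 2 ≤ a 2 → W 1 ≤ a 1 ∸ 1 →
      (∀ i → 3 < i → W i ≤ a i) → Conclusion W
    conclude {W} h3 h2 h1 rest = bounds , h1
      where
      bounds : ∀ k → 2 ≤ k → W k ≤ a k
      bounds (suc zero) (s≤s ())
      bounds (suc (suc zero))          _ = h2
      bounds (suc (suc (suc zero)))    _ = h3
      bounds (suc (suc (suc (suc k)))) _ = rest _ (s≤s (s≤s (s≤s (s≤s z≤n))))

    stepB-final : ∀ w → Inv 0 w → Conclusion (stepB a w)
    stepB-final w I =
      if-dec Conclusion (w 3 <? a 3 ×-dec a 2 <? w 2 ×-dec w 1 ≟ 0) caseB1 λ ¬b1 →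
      if-dec Conclusion (w 3 <? a 3 ×-dec a 2 ≤? w 2 ×-dec w 1 ≤? a 1 ×-dec 0 <? w 1) caseB2 λ ¬b2 →
      if-dec Conclusion (w 3 <? a 3 ×-dec a 2 ≤? w 2 ×-dec a 1 <? w 1) caseB3 λ ¬b3 →
      if-dec Conclusion (w 2 <? a 2 ×-dec a 1 ≤? w 1) caseB4 λ ¬b4 →
      unchanged (lowDigits ¬b1 ¬b2 ¬b3 ¬b4)
      where
      rewritten : ∀ {c3 c2 c1} → c3 ≤ a 3 → c2 ≤ a 2 → c1 ≤ a 1 ∸ 1 → Conclusion (set3 w c3 c2 c1)
      rewritten h3 h2 h1 = conclude h3 h2 h1 λ i h → subst (_≤ a i) (sym (set3-above w _ _ _ i h)) (above I i h)

      low1 : a 1 ≤ w 1 → w 1 ∸ a 1 ≤ a 1 ∸ 1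
      low1 ge1 = <⇒≤∸1 (half-∸-strict ge1 (low I))

      caseB1 : w 3 < a 3 × a 2 < w 2 × w 1 ≡ 0 →
        Conclusion (set3 w (w 3 + 1) (w 2 ∸ (a 2 + 1)) (a 1 ∸ 1))
      caseB1 (lt3 , _ , _) = rewritten (<⇒+1≤ lt3) (half-∸suc (bound (mid I))) ≤-refl

      caseB2 : w 3 < a 3 × a 2 ≤ w 2 × w 1 ≤ a 1 × 0 < w 1 →
        Conclusion (set3 w (w 3 + 1) (w 2 ∸ a 2) (w 1 ∸ 1))
      caseB2 (lt3 , _ , le1 , pos1) =
        rewritten (<⇒+1≤ lt3) (half-∸ (below-full (bound (mid I)) λ e → >⇒≢ pos1 (full (mid I) e)))
          (∸-monoˡ-≤ 1 le1)

      caseB3 : w 3 < a 3 × a 2 ≤ w 2 × a 1 < w 1 →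
        Conclusion (set3 w (w 3 + 1) ((w 2 ∸ a 2) + 1) (w 1 ∸ a 1 ∸ 1))
      caseB3 (lt3 , ge2 , gt1) =
        rewritten (<⇒+1≤ lt3) (<⇒+1≤ (half-∸-strict ge2 lt2A)) (≤-trans (m∸n≤m _ 1) (low1 (<⇒≤ gt1)))
        where
        le2A : w 2 ≤ 2 * a 2
        le2A = below-full (bound (mid I)) λ e → >⇒≢ (≤-<-trans z≤n gt1) (full (mid I) e)
        lt2A : w 2 < 2 * a 2
        lt2A = ≤∧≢⇒< le2A λ e → <⇒≱ gt1 (even (mid I) e)

      caseB4 : w 2 < a 2 × a 1 ≤ w 1 → Conclusion (set3 w (w 3) (w 2 + 1) (w 1 ∸ a 1))
      caseB4 (lt2 , ge1) = rewritten (top I) (<⇒+1≤ lt2) (low1 ge1)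

      unchanged : w 2 ≤ a 2 × w 1 ≤ a 1 ∸ 1 → Conclusion w
      unchanged (h2 , h1) = conclude (top I) h2 h1 (above I)

      lowDigits : ¬ (w 3 < a 3 × a 2 < w 2 × w 1 ≡ 0) →
        ¬ (w 3 < a 3 × a 2 ≤ w 2 × w 1 ≤ a 1 × 0 < w 1) →
        ¬ (w 3 < a 3 × a 2 ≤ w 2 × a 1 < w 1) → ¬ (w 2 < a 2 × a 1 ≤ w 1) →
        w 2 ≤ a 2 × w 1 ≤ a 1 ∸ 1
      lowDigits ¬b1 ¬b2 ¬b3 ¬b4 with w 2 <? a 2
      ... | yes lt2 with a 1 ≤? w 1
      ...   | yes ge1 = ⊥-elim (¬b4 (lt2 , ge1))
      ...   | no ¬ge1 = <⇒≤ lt2 , <⇒≤∸1 (≰⇒> ¬ge1)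
      lowDigits ¬b1 ¬b2 ¬b3 ¬b4 | no ¬lt2 with w 3 <? a 3
      ... | no ¬lt3 = ⊥-elim (¬lt2 (topFull I (≤-antisym (top I) (≮⇒≥ ¬lt3))))
      ... | yes lt3 with a 1 <? w 1
      ...   | yes gt1 = ⊥-elim (¬b3 (lt3 , ≮⇒≥ ¬lt2 , gt1))
      ...   | no ¬gt1 with w 1 ≟ 0
      ...     | no nz = ⊥-elim (¬b2 (lt3 , ≮⇒≥ ¬lt2 , ≮⇒≥ ¬gt1 , n≢0⇒n>0 nz))
      ...     | yes z with a 2 <? w 2
      ...       | yes gt2 = ⊥-elim (¬b1 (lt3 , gt2 , z))
      ...       | no ¬gt2 = ≮⇒≥ ¬gt2 , subst (_≤ a 1 ∸ 1) (sym z) z≤n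

mainTheorem4 : (a : ℕ → ℕ) → (∀ i → 1 ≤ i → 1 ≤ a i) →
    (M N n : ℕ) → 2 ≤ n → (x y : Word) →
    IsOstrowskiRep a n x M → IsOstrowskiRep a n y N →
    (∀ k → 2 ≤ k → k ≤ suc n → algorithm1 a (suc n) (sumWord n x y) k ≤ a k)
    × (algorithm1 a (suc n) (sumWord n x y) 1 ≤ a 1 ∸ 1)
mainTheorem4 a apos M N (suc zero) (s≤s ()) x y ox oy
mainTheorem4 a apos M N (suc (suc j)) _ x y ox oy = (λ k 2≤k _ → proj₁ final k 2≤k) , proj₂ final
  where
  open Digits a (λ p → apos (suc p) (s≤s z≤n))
  s : Word
  s = sumWord (2 + j) x y
  open Run s (sumWord-carry ox oy)
  final : Conclusion (algorithm1 a (3 + j) s)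
  final = stepB-final _ (down j s (start j λ i h → sumWord-outside x y h))
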